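{- Every $\Delta(1,2,2)$-free tournament is $3$-colourable, and a $\Delta(1,2,2)$-free tournament is $2$-colourable if and only if it is $P_7$-free.
   Context: Tournaments are finite; $T$ is $S$-free if no induced subtournament of $T$ is isomorphic to $S$. $\Delta(1,2,2)$ is the tournament on $\{x,y_1,y_2,z_1,z_2\}$ in which every edge between $x$ and $\{y_1,y_2\}$ goes from $x$, every edge between $\{y_1,y_2\}$ and $\{z_1,z_2\}$ goes into $\{z_1,z_2\}$, every edge between $\{z_1,z_2\}$ and $x$ goes into $x$, and $y_1y_2$, $z_1z_2$ are edges. $P_7$ is the tournament on $v_1,\dots,v_7$ with $v_iv_j$ an edge iff $j-i\equiv1,2,4\pmod 7$. For an integer $k\ge1$, a $k$-colouring of a tournament $T$ is a map $f:V(T)\to\{1,\dots,k\}$ such that each colour class $\{v:f(v)=i\}$ induces a transitive subtournament; $T$ is $k$-colourable if it admits one. -}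

module Defs where

open import Data.Nat using (ℕ; zero; suc; _+_; _∸_; _%_)
open import Data.Fin using (Fin; toℕ)
open import Data.Fin.Patterns
open import Data.Bool using (Bool; true; false; not; _∨_; T)
open import Data.Product using (Σ; _×_)
open import Data.Empty using (⊥)
open import Relation.Binary.PropositionalEquality using (_≡_; _≢_)
open import Function.Definitions using (Injective)

record Tournament (n : ℕ) : Set where
  field
    adj  : Fin n → Fin n → Bool
    irr  : ∀ u → adj u u ≡ false
    tour : ∀ u v → u ≢ v → adj u v ≡ not (adj v u)
open Tournament public

_⟶[_]_ : ∀ {n} → Fin n → Tournament n → Fin n → Set
u ⟶[ T' ] v = adj T' u v ≡ true

Contains : ∀ {n m} → Tournament n → Tournament m → Set
Contains {n} {m} T' S =
  Σ (Fin m → Fin n) λ φ → Injective _≡_ _≡_ φ × (∀ a b → adj T' (φ a) (φ b) ≡ adj S a b)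

Free : ∀ {n m} → Tournament n → Tournament m → Set
Free T' S = Contains T' S → ⊥

InducesTransitive : ∀ {n} → Tournament n → (Fin n → Set) → Set
InducesTransitive T' P =
  ∀ u v w → P u → P v → P w → u ⟶[ T' ] v → v ⟶[ T' ] w → u ⟶[ T' ] w

IsColouring : ∀ {n} → Tournament n → (k : ℕ) → (Fin n → Fin k) → Set
IsColouring T' k f = ∀ (i : Fin k) → InducesTransitive T' (λ v → f v ≡ i)

Colourable : ∀ {n} → Tournament n → ℕ → Set
Colourable {n} T' k = Σ (Fin n → Fin k) (IsColouring T' k)

-- Δ(1,2,2) on {x,y1,y2,z1,z2} = {0,1,2,3,4}

Δadj : Fin 5 → Fin 5 → Bool
Δadj 0F 1F = true
Δadj 0F 2F = true
Δadj 1F 2F = true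
Δadj 1F 3F = true
Δadj 1F 4F = true
Δadj 2F 3F = true
Δadj 2F 4F = true
Δadj 3F 4F = true
Δadj 3F 0F = true
Δadj 4F 0F = true
Δadj _ _ = false

Δ-irr : ∀ u → Δadj u u ≡ false
Δ-irr 0F = _≡_.refl
Δ-irr 1F = _≡_.refl
Δ-irr 2F = _≡_.refl
Δ-irr 3F = _≡_.refl
Δ-irr 4F = _≡_.refl

Δ-tour : ∀ u v → u ≢ v → Δadj u v ≡ not (Δadj v u)
Δ-tour 0F 0F p with () ← p _≡_.refl
Δ-tour 0F 1F p = _≡_.refl
Δ-tour 0F 2F p = _≡_.refl
Δ-tour 0F 3F p = _≡_.refl
Δ-tour 0F 4F p = _≡_.refl
Δ-tour 1F 0F p = _≡_.refl
Δ-tour 1F 1F p with () ← p _≡_.refl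
Δ-tour 1F 2F p = _≡_.refl
Δ-tour 1F 3F p = _≡_.refl
Δ-tour 1F 4F p = _≡_.refl
Δ-tour 2F 0F p = _≡_.refl
Δ-tour 2F 1F p = _≡_.refl
Δ-tour 2F 2F p with () ← p _≡_.refl
Δ-tour 2F 3F p = _≡_.refl
Δ-tour 2F 4F p = _≡_.refl
Δ-tour 3F 0F p = _≡_.refl
Δ-tour 3F 1F p = _≡_.refl
Δ-tour 3F 2F p = _≡_.refl
Δ-tour 3F 3F p with () ← p _≡_.refl
Δ-tour 3F 4F p = _≡_.refl
Δ-tour 4F 0F p = _≡_.refl
Δ-tour 4F 1F p = _≡_.refl
Δ-tour 4F 2F p = _≡_.refl
Δ-tour 4F 3F p = _≡_.refl
Δ-tour 4F 4F p with () ← p _≡_.refl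

Δ122 : Tournament 5
Δ122 = record { adj = Δadj ; irr = Δ-irr ; tour = Δ-tour }

-- P7 (Paley tournament) on v1..v7 = 0..6: vi → vj iff j - i ≡ 1,2,4 (mod 7)

isQR : ℕ → Bool
isQR 1 = true
isQR 2 = true
isQR 4 = true
isQR _ = false

P7adj : Fin 7 → Fin 7 → Bool
P7adj i j = isQR ((7 + toℕ j ∸ toℕ i) % 7)

P7-irr : ∀ u → P7adj u u ≡ false
P7-irr 0F = _≡_.refl
P7-irr 1F = _≡_.refl
P7-irr 2F = _≡_.refl
P7-irr 3F = _≡_.refl
P7-irr 4F = _≡_.refl
P7-irr 5F = _≡_.refl
P7-irr 6F = _≡_.refl

P7-tour : ∀ u v → u ≢ v → P7adj u v ≡ not (P7adj v u)
P7-tour 0F 0F p with () ← p _≡_.refl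
P7-tour 0F 1F p = _≡_.refl
P7-tour 0F 2F p = _≡_.refl
P7-tour 0F 3F p = _≡_.refl
P7-tour 0F 4F p = _≡_.refl
P7-tour 0F 5F p = _≡_.refl
P7-tour 0F 6F p = _≡_.refl
P7-tour 1F 0F p = _≡_.refl
P7-tour 1F 1F p with () ← p _≡_.refl
P7-tour 1F 2F p = _≡_.refl
P7-tour 1F 3F p = _≡_.refl
P7-tour 1F 4F p = _≡_.refl
P7-tour 1F 5F p = _≡_.refl
P7-tour 1F 6F p = _≡_.refl
P7-tour 2F 0F p = _≡_.refl
P7-tour 2F 1F p = _≡_.refl
P7-tour 2F 2F p with () ← p _≡_.refl
P7-tour 2F 3F p = _≡_.refl
P7-tour 2F 4F p = _≡_.refl
P7-tour 2F 5F p = _≡_.refl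
P7-tour 2F 6F p = _≡_.refl
P7-tour 3F 0F p = _≡_.refl
P7-tour 3F 1F p = _≡_.refl
P7-tour 3F 2F p = _≡_.refl
P7-tour 3F 3F p with () ← p _≡_.refl
P7-tour 3F 4F p = _≡_.refl
P7-tour 3F 5F p = _≡_.refl
P7-tour 3F 6F p = _≡_.refl
P7-tour 4F 0F p = _≡_.refl
P7-tour 4F 1F p = _≡_.refl
P7-tour 4F 2F p = _≡_.refl
P7-tour 4F 3F p = _≡_.refl
P7-tour 4F 4F p with () ← p _≡_.refl
P7-tour 4F 5F p = _≡_.refl
P7-tour 4F 6F p = _≡_.refl
P7-tour 5F 0F p = _≡_.refl
P7-tour 5F 1F p = _≡_.refl
P7-tour 5F 2F p = _≡_.refl
P7-tour 5F 3F p = _≡_.refl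
P7-tour 5F 4F p = _≡_.refl
P7-tour 5F 5F p with () ← p _≡_.refl
P7-tour 5F 6F p = _≡_.refl
P7-tour 6F 0F p = _≡_.refl
P7-tour 6F 1F p = _≡_.refl
P7-tour 6F 2F p = _≡_.refl
P7-tour 6F 3F p = _≡_.refl
P7-tour 6F 4F p = _≡_.refl
P7-tour 6F 5F p = _≡_.refl
P7-tour 6F 6F p with () ← p _≡_.refl

P7 : Tournament 7
P7 = record { adj = P7adj ; irr = P7-irr ; tour = P7-tour }

-- Induction on the number of vertices: colour T ∖ x and repair the colouring near x. A colour
-- class is transitive iff it contains no cyclic triangle, so only cyclic triangles through the
-- recoloured vertices need checking, and x can take any colour missing from its out-neighbourhood.
-- Hence all out-degrees may be assumed to be at least 3 (for three colours) or 2 (for two).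
-- Δ(1,2,2)-freeness gives the key fact: for a transitive triple y → u → u′, at most one
-- out-neighbour of u′ that returns to y is dominated by u, and at most one dominates u. So an
-- out-neighbour w of x with two in-neighbours in N⁺(x) has smaller out-degree than x, and some x has
-- out-degree exactly 3; following the returns around x exposes a copy of P7 that no arc leaves,
-- which is recoloured with a 3-colouring of P7. For two colours, P7-freeness forces a vertex of
-- out-degree 2, around which the same analysis finds either a copy of the regular 5-tournament that
-- no arc leaves, or a cyclic triangle of out-degree-2 vertices that take the colours opposite to
-- those of their outer out-neighbours. Conversely, P7 itself is not 2-colourable.

{-# OPTIONS --safe #-}
module Submission where

open import Defs
open import Data.Bool using (Bool; true; false; not; _∨_)
open import Data.Bool.Properties using (¬-not) renaming (_≟_ to _≟ᵇ_)
open import Data.Empty using (⊥; ⊥-elim)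
open import Data.Fin using (Fin; zero; suc; toℕ; punchIn; punchOut; opposite)
open import Data.Fin.Patterns
open import Data.Fin.Properties
  using ( _≟_; all?; any?; ¬∀⟶∃¬; suc-injective; punchIn-injective; punchIn-punchOut; punchOut-cong
        ; opposite-involutive)
open import Data.Fin.Subset using (Subset; inside; outside; ∣_∣; _-_; Empty)
  renaming (_∈_ to _∈ˢ_; _⊆_ to _⊆ˢ_; _∪_ to _∪ˢ_)
open import Data.Fin.Subset.Properties
  using (p⊆q⇒∣p∣≤∣q∣; ∣p∣≤∣x∷p∣; ∣⊥∣≡0; Empty-unique; x∈p⇒∣p-x∣<∣p∣; x∈p∧x≢y⇒x∈p-y; x∈p∪q⁺)
open import Data.List using (filter; cartesianProduct; allFin)
open import Data.List.Membership.Propositional.Properties using (∈-filter⁺; ∈-cartesianProduct⁺; ∈-allFin)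
open import Data.List.Relation.Unary.All as All using (All)
open import Data.Nat using (ℕ; zero; suc; _+_; _≤_; _<_; z≤n; s≤s)
open import Data.Nat.DivMod using (_mod_)
open import Data.Nat.Induction using (<-wellFounded)
open import Data.Nat.Properties
  using (≤-trans; ≤-reflexive; +-suc; +-comm; +-mono-≤; +-monoʳ-≤; module ≤-Reasoning)
open import Data.Product using (∃; ∃₂; _×_; _,_; proj₁; proj₂)
open import Data.Sum using (_⊎_; inj₁; inj₂; [_,_]′; map; map₂; swap)
open import Data.Vec using ([]; _∷_; tabulate; here; there)
open import Data.Vec.Properties using (lookup⇒[]=; []=⇒lookup; lookup∘tabulate)
import Data.Vec.Functional as Vector
open import Function using (_∘_)
open import Function.Bundles using (_⇔_; mk⇔)
open import Induction.WellFounded using (Acc; acc)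
open import Level using (0ℓ)
open import Relation.Binary.PropositionalEquality using (_≡_; _≢_; refl; sym; trans; cong; subst; subst₂)
open import Relation.Nullary using (¬_; Dec; yes; no; does)
open import Relation.Nullary.Decidable
  using (_×-dec_; _⊎-dec_; _→-dec_; ¬?; dec-true; decidable-stable; from-yes; from-no)
open import Relation.Unary using (Pred; Decidable; ｛_｝; _∪_; _∩_; _⊆_; Satisfiable)
open import Relation.Unary.Properties using (_∪?_)

AtMostOne : ∀ {A : Set} → Pred A 0ℓ → Set
AtMostOne P = ∀ {a b} → P a → P b → a ≡ b

AtLeast₂ AtLeast₃ : ∀ {A : Set} → Pred A 0ℓ → Set
AtLeast₂ P = ∃₂ λ a b → a ≢ b × P a × P b
AtLeast₃ P = ∃₂ λ a b → ∃ λ c → a ≢ b × a ≢ c × b ≢ c × P a × P b × P c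

module _ {A : Set} {P Q R : Pred A 0ℓ} where

  pigeonhole₂ : AtMostOne Q → AtMostOne R → P ⊆ Q ∪ R → AtLeast₂ P →
                Satisfiable (P ∩ Q) × Satisfiable (P ∩ R)
  pigeonhole₂ oneQ oneR P⊆ (a , b , a≢b , Pa , Pb) with P⊆ Pa | P⊆ Pb
  ... | inj₁ Qa | inj₁ Qb = ⊥-elim (a≢b (oneQ Qa Qb))
  ... | inj₁ Qa | inj₂ Rb = (a , Pa , Qa) , (b , Pb , Rb)
  ... | inj₂ Ra | inj₁ Qb = (b , Pb , Qb) , (a , Pa , Ra)
  ... | inj₂ Ra | inj₂ Rb = ⊥-elim (a≢b (oneR Ra Rb))

  pigeonhole₃ : ∀ {S} → AtMostOne Q → AtMostOne R → AtMostOne S → P ⊆ Q ∪ R ∪ S → AtLeast₃ P →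
                Satisfiable (P ∩ Q) × Satisfiable (P ∩ R) × Satisfiable (P ∩ S)
  pigeonhole₃ oneQ oneR oneS P⊆ (a , b , c , a≢b , a≢c , b≢c , Pa , Pb , Pc)
    with P⊆ Pa | P⊆ Pb | P⊆ Pc
  ... | inj₁ Qa        | inj₁ Qb        | _              = ⊥-elim (a≢b (oneQ Qa Qb))
  ... | inj₁ Qa        | _              | inj₁ Qc        = ⊥-elim (a≢c (oneQ Qa Qc))
  ... | _              | inj₁ Qb        | inj₁ Qc        = ⊥-elim (b≢c (oneQ Qb Qc))
  ... | inj₂ (inj₁ Ra) | inj₂ (inj₁ Rb) | _              = ⊥-elim (a≢b (oneR Ra Rb))
  ... | inj₂ (inj₁ Ra) | _              | inj₂ (inj₁ Rc) = ⊥-elim (a≢c (oneR Ra Rc))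
  ... | _              | inj₂ (inj₁ Rb) | inj₂ (inj₁ Rc) = ⊥-elim (b≢c (oneR Rb Rc))
  ... | inj₂ (inj₂ Sa) | inj₂ (inj₂ Sb) | _              = ⊥-elim (a≢b (oneS Sa Sb))
  ... | inj₂ (inj₂ Sa) | _              | inj₂ (inj₂ Sc) = ⊥-elim (a≢c (oneS Sa Sc))
  ... | _              | inj₂ (inj₂ Sb) | inj₂ (inj₂ Sc) = ⊥-elim (b≢c (oneS Sb Sc))
  ... | inj₁ Qa        | inj₂ (inj₁ Rb) | inj₂ (inj₂ Sc) = (a , Pa , Qa) , (b , Pb , Rb) , (c , Pc , Sc)
  ... | inj₁ Qa        | inj₂ (inj₂ Sb) | inj₂ (inj₁ Rc) = (a , Pa , Qa) , (c , Pc , Rc) , (b , Pb , Sb)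
  ... | inj₂ (inj₁ Ra) | inj₁ Qb        | inj₂ (inj₂ Sc) = (b , Pb , Qb) , (a , Pa , Ra) , (c , Pc , Sc)
  ... | inj₂ (inj₁ Ra) | inj₂ (inj₂ Sb) | inj₁ Qc        = (c , Pc , Qc) , (a , Pa , Ra) , (b , Pb , Sb)
  ... | inj₂ (inj₂ Sa) | inj₁ Qb        | inj₂ (inj₁ Rc) = (b , Pb , Qb) , (c , Pc , Rc) , (a , Pa , Sa)
  ... | inj₂ (inj₂ Sa) | inj₂ (inj₁ Rb) | inj₁ Qc        = (c , Pc , Qc) , (b , Pb , Rb) , (a , Pa , Sa)

  ⊆-∪-swap : ∀ {S : Pred A 0ℓ} → P ⊆ Q ∪ R ∪ S → P ⊆ Q ∪ S ∪ R
  ⊆-∪-swap P⊆ = map₂ swap ∘ P⊆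

  ⊆-∪-rotate : ∀ {S : Pred A 0ℓ} → P ⊆ Q ∪ R ∪ S → P ⊆ R ∪ S ∪ Q
  ⊆-∪-rotate P⊆ = [ inj₂ ∘ inj₂ , map₂ inj₁ ]′ ∘ P⊆

∉-three : ∀ {A : Set} {a b c z : A} → a ≢ z → b ≢ z → c ≢ z → ¬ (｛ a ｝ ∪ ｛ b ｝ ∪ ｛ c ｝) z
∉-three a≢z b≢z c≢z = [ a≢z , [ b≢z , c≢z ]′ ]′

module _ {n : ℕ} {P Q : Pred (Fin n) 0ℓ} (P? : Decidable P) (Q? : Decidable Q) where

  escape-or-⊆ : (∃ λ z → P z × ¬ Q z) ⊎ P ⊆ Q
  escape-or-⊆ with any? (λ z → P? z ×-dec ¬? (Q? z))
  ... | yes escape = inj₁ escape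
  ... | no ¬escape = inj₂ λ {z} Pz → decidable-stable (Q? z) (λ ¬Qz → ¬escape (z , Pz , ¬Qz))

  ⊆-dec : Dec (P ⊆ Q)
  ⊆-dec with escape-or-⊆
  ... | inj₁ (z , Pz , ¬Qz) = no λ P⊆Q → ¬Qz (P⊆Q Pz)
  ... | inj₂ P⊆Q = yes P⊆Q

atLeast₃? : ∀ {n} {P : Pred (Fin n) 0ℓ} → Decidable P → Dec (AtLeast₃ P)
atLeast₃? P? = any? λ a → any? λ b → any? λ c →
  ¬? (a ≟ b) ×-dec ¬? (a ≟ c) ×-dec ¬? (b ≟ c) ×-dec P? a ×-dec P? b ×-dec P? c

anyFunction? : ∀ {n k} {P : Pred (Fin n → Fin k) 0ℓ} →
               (∀ {f g} → (∀ i → f i ≡ g i) → P f → P g) → Decidable P → Dec (∃ P)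
anyFunction? {zero} resp P? with P? (λ ())
... | yes Pf = yes (_ , Pf)
... | no ¬Pf = no λ (f , Pf) → ¬Pf (resp (λ ()) Pf)
anyFunction? {suc n} resp P?
  with any? (λ c → anyFunction? (λ f≗g → resp λ { zero → refl ; (suc i) → f≗g i })
                                (λ g → P? (c Vector.∷ g)))
... | yes (c , g , Pf) = yes (c Vector.∷ g , Pf)
... | no ¬Pf = no λ (f , Pf) →
  ¬Pf (f zero , f ∘ suc , resp (λ { zero → refl ; (suc i) → refl }) Pf)

subset : ∀ {n} {P : Pred (Fin n) 0ℓ} → Decidable P → Subset n
subset P? = tabulate (does ∘ P?)

module _ {n} {P : Pred (Fin n) 0ℓ} (P? : Decidable P) where

  ∈-subset⁺ : ∀ {z} → P z → z ∈ˢ subset P?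
  ∈-subset⁺ {z} Pz = lookup⇒[]= z _ (trans (lookup∘tabulate _ z) (dec-true (P? z) Pz))

  ∈-subset⁻ : ∀ {z} → z ∈ˢ subset P? → P z
  ∈-subset⁻ {z} z∈ with P? z | trans (sym (lookup∘tabulate (does ∘ P?) z)) ([]=⇒lookup z∈)
  ... | yes Pz | _  = Pz
  ... | no _   | ()

∣p∪q∣≤∣p∣+∣q∣ : ∀ {n} (p q : Subset n) → ∣ p ∪ˢ q ∣ ≤ ∣ p ∣ + ∣ q ∣
∣p∪q∣≤∣p∣+∣q∣ []            []            = z≤n
∣p∪q∣≤∣p∣+∣q∣ (outside ∷ p) (outside ∷ q) = ∣p∪q∣≤∣p∣+∣q∣ p q
∣p∪q∣≤∣p∣+∣q∣ (outside ∷ p) (inside ∷ q)  =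
  subst (∣ p ∪ˢ q ∣ <_) (sym (+-suc ∣ p ∣ ∣ q ∣)) (s≤s (∣p∪q∣≤∣p∣+∣q∣ p q))
∣p∪q∣≤∣p∣+∣q∣ (inside ∷ p)  (s ∷ q)       =
  s≤s (≤-trans (∣p∪q∣≤∣p∣+∣q∣ p q) (+-monoʳ-≤ ∣ p ∣ (∣p∣≤∣x∷p∣ s q)))

∣p∣≤1 : ∀ {n} (p : Subset n) → AtMostOne (_∈ˢ p) → ∣ p ∣ ≤ 1
∣p∣≤1         []            _   = z≤n
∣p∣≤1         (outside ∷ p) one = ∣p∣≤1 p λ x∈p y∈p → suc-injective (one (there x∈p) (there y∈p))
∣p∣≤1 {suc n} (inside ∷ p)  one = s≤s (≤-reflexive (trans (cong ∣_∣ (Empty-unique empty)) (∣⊥∣≡0 n)))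
  where
  empty : Empty p
  empty (y , y∈p) with () ← one here (there y∈p)

module Arcs {n : ℕ} (T : Tournament n) where

  infix 4 _⟶_ _⟶?_

  _⟶_ : Fin n → Fin n → Set
  u ⟶ v = u ⟶[ T ] v

  _⟶?_ : ∀ u v → Dec (u ⟶ v)
  u ⟶? v = adj T u v ≟ᵇ true

  N⁺ : Fin n → Pred (Fin n) 0ℓ
  N⁺ u = u ⟶_

  ⟶-irrefl : ∀ {u} → ¬ u ⟶ u
  ⟶-irrefl {u} u⟶u with () ← trans (sym u⟶u) (irr T u)

  ⟶⇒≢ : ∀ {u v} → u ⟶ v → u ≢ v
  ⟶⇒≢ u⟶u refl = ⟶-irrefl u⟶u

  ⟶⇒≢˘ : ∀ {u v} → u ⟶ v → v ≢ u
  ⟶⇒≢˘ u⟶u refl = ⟶-irrefl u⟶u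

  ⟵⇒adj≡false : ∀ {u v} → v ⟶ u → adj T u v ≡ false
  ⟵⇒adj≡false {u} {v} v⟶u = trans (tour T u v (⟶⇒≢˘ v⟶u)) (cong not v⟶u)

  ⟶-asym : ∀ {u v} → u ⟶ v → ¬ v ⟶ u
  ⟶-asym u⟶v v⟶u with () ← trans (sym u⟶v) (⟵⇒adj≡false v⟶u)

  ⟶-total : ∀ {u v} → u ≢ v → ¬ u ⟶ v → v ⟶ u
  ⟶-total {u} {v} u≢v ¬u⟶v = trans (tour T v u (u≢v ∘ sym)) (cong not (¬-not ¬u⟶v))

  ⟶-connex : ∀ {u v} → u ≢ v → u ⟶ v ⊎ v ⟶ u
  ⟶-connex {u} {v} u≢v with u ⟶? v
  ... | yes u⟶v = inj₁ u⟶v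
  ... | no ¬u⟶v = inj₂ (⟶-total u≢v ¬u⟶v)

  Cyclic : Fin n → Fin n → Fin n → Set
  Cyclic a b c = a ⟶ b × b ⟶ c × c ⟶ a

  cyclic-rotate : ∀ {a b c} → Cyclic a b c → Cyclic b c a
  cyclic-rotate (ab , bc , ca) = bc , ca , ab

  Monochromatic : ∀ {k} → (Fin n → Fin k) → Fin n → Fin n → Fin n → Set
  Monochromatic f a b c = f a ≡ f b × f b ≡ f c

  monochromatic-rotate : ∀ {k} {f : Fin n → Fin k} {a b c} →
                         Monochromatic f a b c → Monochromatic f b c a
  monochromatic-rotate (fab , fbc) = fbc , sym (trans fab fbc)

  ProperlyColours : ∀ {k} → (Fin n → Fin k) → Set
  ProperlyColours f = ∀ {a b c} → Cyclic a b c → ¬ Monochromatic f a b c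

  colouring⇒proper : ∀ {k f} → IsColouring T k f → ProperlyColours f
  colouring⇒proper {f = f} colours {a} (ab , bc , ca) (fab , fbc) =
    ⟶-asym (colours (f a) a _ _ refl (sym fab) (sym (trans fab fbc)) ab bc) ca

  proper⇒colouring : ∀ {k f} → ProperlyColours {k} f → IsColouring T k f
  proper⇒colouring proper i u v w fu fv fw uv vw with u ⟶? w
  ... | yes uw = uw
  ... | no ¬uw = ⊥-elim (proper (uv , vw , ⟶-total u≢w ¬uw) (trans fu (sym fv) , trans fv (sym fw)))
    where
    u≢w : u ≢ w
    u≢w refl = ⟶-asym uv vw

  outdegree : Fin n → ℕ
  outdegree u = ∣ subset (u ⟶?_) ∣

  outdegree≥2 : (∀ x w → ¬ N⁺ x ⊆ ｛ w ｝) → ∀ x → AtLeast₂ (N⁺ x)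
  outdegree≥2 uncovered x =
    let a , xa , _   = escape x
        b , xb , a≢b = escape a
    in a , b , a≢b , xa , xb
    where
    escape : ∀ w → ∃ λ z → x ⟶ z × w ≢ z
    escape w with escape-or-⊆ (x ⟶?_) (w ≟_)
    ... | inj₁ escaped = escaped
    ... | inj₂ covered = ⊥-elim (uncovered x w covered)

  outdegree≥3 : (∀ x w₁ w₂ → ¬ N⁺ x ⊆ ｛ w₁ ｝ ∪ ｛ w₂ ｝) → ∀ x → AtLeast₃ (N⁺ x)
  outdegree≥3 uncovered x =
    let a , xa , _         = escape x x
        b , xb , a≢b , _   = escape a a
        c , xc , a≢c , b≢c = escape a b
    in a , b , c , a≢b , a≢c , b≢c , xa , xb , xc
    where
    escape : ∀ w₁ w₂ → ∃ λ z → x ⟶ z × w₁ ≢ z × w₂ ≢ z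
    escape w₁ w₂ with escape-or-⊆ (x ⟶?_) ((w₁ ≟_) ∪? (w₂ ≟_))
    ... | inj₁ (z , xz , z∉) = z , xz , z∉ ∘ inj₁ , z∉ ∘ inj₂
    ... | inj₂ covered       = ⊥-elim (uncovered x w₁ w₂ covered)

  outdegree-exactly-2 : ∀ {x} → AtLeast₂ (N⁺ x) → ¬ AtLeast₃ (N⁺ x) →
                        ∃₂ λ p q → x ⟶ p × x ⟶ q × p ⟶ q × N⁺ x ⊆ ｛ p ｝ ∪ ｛ q ｝
  outdegree-exactly-2 {x} (p , q , p≢q , xp , xq) ¬three with escape-or-⊆ (x ⟶?_) ((p ≟_) ∪? (q ≟_))
  ... | inj₁ (r , xr , r∉) = ⊥-elim (¬three (p , q , r , p≢q , r∉ ∘ inj₁ , r∉ ∘ inj₂ , xp , xq , xr))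
  ... | inj₂ Nx with ⟶-connex p≢q
  ...   | inj₁ pq = p , q , xp , xq , pq , Nx
  ...   | inj₂ qp = q , p , xq , xp , qp , swap ∘ Nx

  private
    cyclic-with-fourth : ∀ {P : Pred (Fin n) 0ℓ} {a b c d} → a ≢ d → b ≢ d → c ≢ d →
                         P a → P b → P c → P d → Cyclic a b c →
                         ∃₂ λ w i → ∃ λ j → P w × P i × P j × i ≢ j × i ⟶ w × j ⟶ w
    cyclic-with-fourth {a = a} {b} {c} {d} a≢d b≢d c≢d Pa Pb Pc Pd (ab , bc , ca) with d ⟶? a | b ⟶? d
    ... | yes da | _      = a , c , d , Pa , Pc , Pd , c≢d , ca , da
    ... | no ¬da | yes bd = d , a , b , Pd , Pa , Pb , ⟶⇒≢ ab , ⟶-total (a≢d ∘ sym) ¬da , bd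
    ... | no ¬da | no ¬bd = b , a , d , Pb , Pa , Pd , a≢d , ab , ⟶-total b≢d ¬bd

  two-in-neighbours : ∀ {P : Pred (Fin n) 0ℓ} {a b c d} →
                      a ≢ b → a ≢ c → a ≢ d → b ≢ c → b ≢ d → c ≢ d → P a → P b → P c → P d →
                      ∃₂ λ w i → ∃ λ j → P w × P i × P j × i ≢ j × i ⟶ w × j ⟶ w
  two-in-neighbours {a = a} {b} {c} {d} a≢b a≢c a≢d b≢c b≢d c≢d Pa Pb Pc Pd
    with ⟶-connex a≢b | ⟶-connex b≢c | ⟶-connex a≢c
  ... | inj₁ ab | inj₂ cb | _       = b , a , c , Pb , Pa , Pc , a≢c , ab , cb
  ... | inj₂ ba | _       | inj₂ ca = a , b , c , Pa , Pb , Pc , b≢c , ba , ca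
  ... | _       | inj₁ bc | inj₁ ac = c , a , b , Pc , Pa , Pb , a≢b , ac , bc
  ... | inj₁ ab | inj₁ bc | inj₂ ca = cyclic-with-fourth a≢d b≢d c≢d Pa Pb Pc Pd (ab , bc , ca)
  ... | inj₂ ba | inj₂ cb | inj₁ ac = cyclic-with-fourth a≢d c≢d b≢d Pa Pc Pb Pd (ac , cb , ba)

module _ {m n : ℕ} (S : Tournament m) {T : Tournament n} where
  private
    module S = Arcs S
    module T = Arcs T

  embedding : (φ : Fin m → Fin n) → (∀ {a b} → a S.⟶ b → φ a T.⟶ φ b) → Contains T S
  embedding φ φ-arc = φ , injective , adj-φ
    where
    injective : ∀ {a b} → φ a ≡ φ b → a ≡ b
    injective {a} {b} φa≡φb with a ≟ b
    ... | yes a≡b = a≡b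
    ... | no a≢b with S.⟶-connex a≢b
    ...   | inj₁ ab = ⊥-elim (T.⟶⇒≢ (φ-arc ab) φa≡φb)
    ...   | inj₂ ba = ⊥-elim (T.⟶⇒≢˘ (φ-arc ba) φa≡φb)
    adj-φ : ∀ a b → adj T (φ a) (φ b) ≡ adj S a b
    adj-φ a b with a ≟ b
    ... | yes refl = trans (irr T (φ a)) (sym (irr S a))
    ... | no a≢b with S.⟶-connex a≢b
    ...   | inj₁ ab = trans (φ-arc ab) (sym ab)
    ...   | inj₂ ba = trans (T.⟵⇒adj≡false (φ-arc ba)) (sym (S.⟵⇒adj≡false ba))

  embeddingFromArcs : (φ : Fin m → Fin n) →
    All (λ (a , b) → φ a T.⟶ φ b) (filter (λ (a , b) → a S.⟶? b) (cartesianProduct (allFin m) (allFin m))) →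
    Contains T S
  embeddingFromArcs φ arcs = embedding φ λ {a} {b} ab →
    All.lookup arcs (∈-filter⁺ (λ (a , b) → a S.⟶? b) (∈-cartesianProduct⁺ (∈-allFin a) (∈-allFin b)) ab)

Contains-trans : ∀ {k m n} {T : Tournament n} {U : Tournament m} {S : Tournament k} →
                 Contains T U → Contains U S → Contains T S
Contains-trans (φ , φ-injective , adj-φ) (ψ , ψ-injective , adj-ψ) =
  φ ∘ ψ , ψ-injective ∘ φ-injective , λ a b → trans (adj-φ (ψ a) (ψ b)) (adj-ψ a b)

colouring-⊇ : ∀ {m n k} {T : Tournament n} {S : Tournament m} {f : Fin n → Fin k} →
              ((φ , _) : Contains T S) → IsColouring T k f → IsColouring S k (f ∘ φ)
colouring-⊇ (φ , _ , adj-φ) colours i u v w fu fv fw uv vw =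
  trans (sym (adj-φ u w)) (colours i (φ u) (φ v) (φ w) fu fv fw (trans (adj-φ u v) uv) (trans (adj-φ v w) vw))

Colourable-⊇ : ∀ {m n k} {T : Tournament n} {S : Tournament m} →
               Contains T S → Colourable T k → Colourable S k
Colourable-⊇ {T = T} {S} copy (f , colours) = f ∘ proj₁ copy , colouring-⊇ {T = T} {S} copy colours

_∖_ : ∀ {n} → Tournament (suc n) → Fin (suc n) → Tournament n
T ∖ x = record
  { adj  = λ i j → adj T (punchIn x i) (punchIn x j)
  ; irr  = λ i → irr T (punchIn x i)
  ; tour = λ i j i≢j → tour T (punchIn x i) (punchIn x j) (i≢j ∘ punchIn-injective x i j)
  }

Free-∖ : ∀ {m n} {T : Tournament (suc n)} {S : Tournament m} {x} → Free T S → Free (T ∖ x) S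
Free-∖ {T = T} {S} {x} free =
  free ∘ Contains-trans {T = T} {T ∖ x} {S} (punchIn x , punchIn-injective x _ _ , λ _ _ → refl)

-- Small tournaments, by computation

isColouring? : ∀ {n} (T : Tournament n) k f → Dec (IsColouring T k f)
isColouring? T k f = all? λ i → all? λ u → all? λ v → all? λ w →
  f u ≟ i →-dec f v ≟ i →-dec f w ≟ i →-dec u ⟶? v →-dec v ⟶? w →-dec u ⟶? w
  where open Arcs T

colourable? : ∀ {n} (T : Tournament n) k → Dec (Colourable T k)
colourable? T k = anyFunction? colouring-resp (isColouring? T k)
  where
  colouring-resp : ∀ {f g} → (∀ i → f i ≡ g i) → IsColouring T k f → IsColouring T k g
  colouring-resp f≗g colours i u v w gu gv gw =
    colours i u v w (trans (f≗g u) gu) (trans (f≗g v) gv) (trans (f≗g w) gw)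

_⊕_ : ∀ {m} → Fin (suc m) → ℕ → Fin (suc m)
i ⊕ d = (toℕ i + d) mod _

C5 : Tournament 5
C5 = record
  { adj  = C5adj
  ; irr  = from-yes (all? λ u → C5adj u u ≟ᵇ false)
  ; tour = from-yes (all? λ u → all? λ v → ¬? (u ≟ v) →-dec C5adj u v ≟ᵇ not (C5adj v u))
  }
  where
  C5adj : Fin 5 → Fin 5 → Bool
  C5adj i j = does (j ≟ i ⊕ 1) ∨ does (j ≟ i ⊕ 2)

C5-arc : ∀ {a b} → a ⟶[ C5 ] b → b ≡ a ⊕ 1 ⊎ b ≡ a ⊕ 2
C5-arc {a} {b} = from-yes (all? λ a → all? λ b →
  adj C5 a b ≟ᵇ true →-dec ((b ≟ a ⊕ 1) ⊎-dec (b ≟ a ⊕ 2))) a b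

P7-arc : ∀ {a b} → a ⟶[ P7 ] b → b ≡ a ⊕ 1 ⊎ b ≡ a ⊕ 2 ⊎ b ≡ a ⊕ 4
P7-arc {a} {b} = from-yes (all? λ a → all? λ b →
  adj P7 a b ≟ᵇ true →-dec ((b ≟ a ⊕ 1) ⊎-dec (b ≟ a ⊕ 2) ⊎-dec (b ≟ a ⊕ 4))) a b

C5-2-colourable : Colourable C5 2
C5-2-colourable = from-yes (colourable? C5 2)

P7-3-colourable : Colourable P7 3
P7-3-colourable = from-yes (colourable? P7 3)

P7-not-2-colourable : ¬ Colourable P7 2
P7-not-2-colourable = from-no (colourable? P7 2)

missing-colour₂ : ∀ (a : Fin 2) → ∃ λ i → a ≢ i
missing-colour₂ = from-yes (all? {2} λ a → any? λ i → ¬? (a ≟ i))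

missing-colour₃ : ∀ (a b : Fin 3) → ∃ λ i → a ≢ i × b ≢ i
missing-colour₃ = from-yes (all? {3} λ a → all? {3} λ b → any? λ i → ¬? (a ≟ i) ×-dec ¬? (b ≟ i))

module _ {n : ℕ} (T : Tournament n) where
  open Arcs T

  record OutClosedCopy {m} (S : Tournament m) : Set where
    field
      φ      : Fin m → Fin n
      φ-arc  : ∀ {a b} → a ⟶[ S ] b → φ a ⟶ φ b
      closed : ∀ {a z} → φ a ⟶ z → ∃ λ b → φ b ≡ z

    contains : Contains T S
    contains = embedding S {T = T} φ φ-arc

  module _ {m} (φ : Fin m → Fin n) where

    Image : Pred (Fin n) 0ℓ
    Image z = ∃ λ b → φ b ≡ z

    ⊆-image₂ : ∀ {P : Pred (Fin n) 0ℓ} i j → P ⊆ ｛ φ i ｝ ∪ ｛ φ j ｝ → P ⊆ Image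
    ⊆-image₂ i j P⊆ = [ (i ,_) , (j ,_) ]′ ∘ P⊆

    ⊆-image₃ : ∀ {P : Pred (Fin n) 0ℓ} i j k → P ⊆ ｛ φ i ｝ ∪ ｛ φ j ｝ ∪ ｛ φ k ｝ → P ⊆ Image
    ⊆-image₃ i j k P⊆ = [ (i ,_) , [ (j ,_) , (k ,_) ]′ ]′ ∘ P⊆

  C5-copy : (φ : Fin 5 → Fin n) → (∀ i → φ i ⟶ φ (i ⊕ 1) × φ i ⟶ φ (i ⊕ 2)) →
            (∀ i → N⁺ (φ i) ⊆ Image φ) → OutClosedCopy C5
  C5-copy φ out closed = record { φ = φ ; φ-arc = arc ; closed = closed _ }
    where
    arc : ∀ {a b} → a ⟶[ C5 ] b → φ a ⟶ φ b
    arc {a} {b} ab with C5-arc {a} {b} ab | out a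
    ... | inj₁ refl | e , _ = e
    ... | inj₂ refl | _ , e = e

  P7-copy : (φ : Fin 7 → Fin n) → (∀ i → φ i ⟶ φ (i ⊕ 1) × φ i ⟶ φ (i ⊕ 2) × φ i ⟶ φ (i ⊕ 4)) →
            (∀ i → N⁺ (φ i) ⊆ Image φ) → OutClosedCopy P7
  P7-copy φ out closed = record { φ = φ ; φ-arc = arc ; closed = closed _ }
    where
    arc : ∀ {a b} → a ⟶[ P7 ] b → φ a ⟶ φ b
    arc {a} {b} ab with P7-arc {a} {b} ab | out a
    ... | inj₁ refl        | e , _ , _ = e
    ... | inj₂ (inj₁ refl) | _ , e , _ = e
    ... | inj₂ (inj₂ refl) | _ , _ , e = e

-- Extending a colouring of T ∖ x

module Recolouring {n k : ℕ} {T : Tournament (suc n)} (x : Fin (suc n))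
                   {c : Fin n → Fin k} (c-colours : IsColouring (T ∖ x) k c) where
  open Arcs T

  extend : Fin k → Fin (suc n) → Fin k
  extend i w with x ≟ w
  ... | yes _   = i
  ... | no x≢w = c (punchOut x≢w)

  extend-x : ∀ {i} → extend i x ≡ i
  extend-x with x ≟ x
  ... | yes _   = refl
  ... | no x≢x = ⊥-elim (x≢x refl)

  extend-≢ : ∀ {i w} (x≢w : x ≢ w) → extend i w ≡ c (punchOut x≢w)
  extend-≢ {w = w} x≢w with x ≟ w
  ... | yes x≡w = ⊥-elim (x≢w x≡w)
  ... | no _     = cong c (punchOut-cong x refl)

  extend-irrelevant : ∀ {i j w} → x ≢ w → extend i w ≡ extend j w
  extend-irrelevant x≢w = trans (extend-≢ x≢w) (sym (extend-≢ x≢w))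

  extend-proper : ∀ {i a b d} → x ≢ a → x ≢ b → x ≢ d → Cyclic a b d → ¬ Monochromatic (extend i) a b d
  extend-proper x≢a x≢b x≢d (ab , bd , da) (iab , ibd) =
    Arcs.colouring⇒proper (T ∖ x) c-colours
      (punchOut-arc x≢a x≢b ab , punchOut-arc x≢b x≢d bd , punchOut-arc x≢d x≢a da)
      (trans (sym (extend-≢ x≢a)) (trans iab (extend-≢ x≢b)) ,
       trans (sym (extend-≢ x≢b)) (trans ibd (extend-≢ x≢d)))
    where
    punchOut-arc : ∀ {u v} (x≢u : x ≢ u) (x≢v : x ≢ v) → u ⟶ v → punchOut x≢u ⟶[ T ∖ x ] punchOut x≢v
    punchOut-arc x≢u x≢v =
      subst₂ (λ a b → adj T a b ≡ true) (sym (punchIn-punchOut x≢u)) (sym (punchIn-punchOut x≢v))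

  -- A monochromatic cyclic triangle avoiding X would be one of T ∖ x under c.
  recolour : ∀ {X : Pred (Fin (suc n)) 0ℓ} → Decidable X → X x → ∀ {i} (f : Fin (suc n) → Fin k) →
             (∀ {w} → ¬ X w → f w ≡ extend i w) →
             (∀ {a b d} → X a → Cyclic a b d → ¬ Monochromatic f a b d) → IsColouring T k f
  recolour {X} X? Xx f off-X on-X = proper⇒colouring proper
    where
    x≢ : ∀ {w} → ¬ X w → x ≢ w
    x≢ ¬Xw refl = ¬Xw Xx
    proper : ProperlyColours f
    proper {a} {b} {d} abd mono with X? a | X? b | X? d
    ... | yes Xa | _      | _      = on-X Xa abd mono
    ... | _      | yes Xb | _      = on-X Xb (cyclic-rotate abd) (monochromatic-rotate {f = f} mono)
    ... | _      | _      | yes Xd =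
      on-X Xd (cyclic-rotate (cyclic-rotate abd))
              (monochromatic-rotate {f = f} (monochromatic-rotate {f = f} mono))
    ... | no ¬Xa | no ¬Xb | no ¬Xd = extend-proper (x≢ ¬Xa) (x≢ ¬Xb) (x≢ ¬Xd) abd
      (trans (sym (off-X ¬Xa)) (trans (proj₁ mono) (off-X ¬Xb)) ,
       trans (sym (off-X ¬Xb)) (trans (proj₂ mono) (off-X ¬Xd)))

  extend-missing : ∀ {i j} → (∀ {w} → x ⟶ w → extend j w ≢ i) → Colourable T k
  extend-missing {i} {j} missing = extend i , recolour (x ≟_) refl (extend i) (λ _ → refl) through-x
    where
    through-x : ∀ {a b d} → x ≡ a → Cyclic a b d → ¬ Monochromatic (extend i) a b d
    through-x refl (xb , _ , _) (same , _) =
      missing xb (trans (extend-irrelevant (⟶⇒≢ xb)) (trans (sym same) extend-x))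

  recolour-copy : ∀ {m} {S : Tournament m} (copy : OutClosedCopy T S) → Image T (OutClosedCopy.φ copy) x →
                  Colourable S k → Colourable T k
  recolour-copy {S = S} copy (a₀ , φa₀≡x) (g , g-colours) =
    paint , recolour image? (a₀ , φa₀≡x) paint paint-outside paint-inside
    where
    open OutClosedCopy copy
    image? : Decidable (Image T φ)
    image? w = any? λ a → φ a ≟ w
    paint : Fin (suc n) → Fin k
    paint w with image? w
    ... | yes (a , _) = g a
    ... | no _        = extend (g a₀) w
    paint-φ : ∀ a → paint (φ a) ≡ g a
    paint-φ a with image? (φ a)
    ... | yes (b , φb≡φa) = cong g (proj₁ (proj₂ contains) φb≡φa)
    ... | no ∉image      = ⊥-elim (∉image (a , refl))
    paint-outside : ∀ {w} → ¬ Image T φ w → paint w ≡ extend (g a₀) w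
    paint-outside {w} ∉image with image? w
    ... | yes ∈image = ⊥-elim (∉image ∈image)
    ... | no _       = refl
    reflect : ∀ {a b} → φ a ⟶ φ b → a ⟶[ S ] b
    reflect {a} {b} = trans (sym (proj₂ (proj₂ contains) a b))
    paint-inside : ∀ {u v w} → Image T φ u → Cyclic u v w → ¬ Monochromatic paint u v w
    paint-inside (a , refl) (uv , vw , wu) (puv , pvw) with closed uv
    ... | b , refl with closed vw
    ... | d , refl = Arcs.colouring⇒proper S g-colours (reflect uv , reflect vw , reflect wu)
      (trans (sym (paint-φ a)) (trans puv (paint-φ b)) , trans (sym (paint-φ b)) (trans pvw (paint-φ d)))

module TriangleRecolouring {n : ℕ} {T : Tournament (suc n)} (x : Fin (suc n))
                           {c : Fin n → Fin 2} (c-colours : IsColouring (T ∖ x) 2 c) where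
  open Arcs T
  open Recolouring {T = T} x c-colours

  -- x, r₁, r₂ get the colours opposite to those of s₀, s₁, s₂, so x r₁ r₂ is monochromatic
  -- only if s₀ s₁ s₂ is.
  recolour-triangle : ∀ {r₁ r₂ s₀ s₁ s₂} → x ⟶ r₁ → r₁ ⟶ r₂ → r₂ ⟶ x →
                      N⁺ x ⊆ ｛ r₁ ｝ ∪ ｛ s₀ ｝ → N⁺ r₁ ⊆ ｛ r₂ ｝ ∪ ｛ s₁ ｝ → N⁺ r₂ ⊆ ｛ x ｝ ∪ ｛ s₂ ｝ →
                      Cyclic s₀ s₂ s₁ →
                      ¬ (｛ x ｝ ∪ ｛ r₁ ｝ ∪ ｛ r₂ ｝) s₀ → ¬ (｛ x ｝ ∪ ｛ r₁ ｝ ∪ ｛ r₂ ｝) s₁ →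
                      ¬ (｛ x ｝ ∪ ｛ r₁ ｝ ∪ ｛ r₂ ｝) s₂ → Colourable T 2
  recolour-triangle {r₁} {r₂} {s₀} {s₁} {s₂} xr₁ r₁r₂ r₂x Nx Nr₁ Nr₂ s-cyclic s₀∉ s₁∉ s₂∉ =
    paint , recolour ((x ≟_) ∪? (r₁ ≟_) ∪? (r₂ ≟_)) (inj₁ refl) paint paint-outside on-triangle
    where
    old : Fin (suc n) → Fin 2
    old = extend 0F

    paint : Fin (suc n) → Fin 2
    paint w with x ≟ w | r₁ ≟ w | r₂ ≟ w
    ... | yes _ | _     | _     = opposite (old s₀)
    ... | no _  | yes _ | _     = opposite (old s₁)
    ... | no _  | no _  | yes _ = opposite (old s₂)
    ... | no _  | no _  | no _  = old w

    paint-x : paint x ≡ opposite (old s₀)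
    paint-x with x ≟ x
    ... | yes _  = refl
    ... | no x≢x = ⊥-elim (x≢x refl)

    paint-r₁ : paint r₁ ≡ opposite (old s₁)
    paint-r₁ with x ≟ r₁ | r₁ ≟ r₁
    ... | yes x≡r₁ | _        = ⊥-elim (⟶⇒≢ xr₁ x≡r₁)
    ... | no _     | yes _    = refl
    ... | no _     | no r₁≢r₁ = ⊥-elim (r₁≢r₁ refl)

    paint-r₂ : paint r₂ ≡ opposite (old s₂)
    paint-r₂ with x ≟ r₂ | r₁ ≟ r₂ | r₂ ≟ r₂
    ... | yes x≡r₂ | _         | _        = ⊥-elim (⟶⇒≢˘ r₂x x≡r₂)
    ... | no _     | yes r₁≡r₂ | _        = ⊥-elim (⟶⇒≢ r₁r₂ r₁≡r₂)
    ... | no _     | no _      | yes _    = refl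
    ... | no _     | no _      | no r₂≢r₂ = ⊥-elim (r₂≢r₂ refl)

    paint-outside : ∀ {w} → ¬ (｛ x ｝ ∪ ｛ r₁ ｝ ∪ ｛ r₂ ｝) w → paint w ≡ old w
    paint-outside {w} w∉ with x ≟ w | r₁ ≟ w | r₂ ≟ w
    ... | yes x≡w | _        | _        = ⊥-elim (w∉ (inj₁ x≡w))
    ... | no _    | yes r₁≡w | _        = ⊥-elim (w∉ (inj₂ (inj₁ r₁≡w)))
    ... | no _    | no _     | yes r₂≡w = ⊥-elim (w∉ (inj₂ (inj₂ r₂≡w)))
    ... | no x≢w  | no _     | no _     = extend-≢ x≢w

    opposite-colour : ∀ {r s} → paint r ≡ opposite (old s) → ¬ (｛ x ｝ ∪ ｛ r₁ ｝ ∪ ｛ r₂ ｝) s → paint r ≢ paint s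
    opposite-colour {r} {s} paint-r s∉ same =
      differs (old s) (trans (sym paint-r) (trans same (paint-outside s∉)))
      where
      differs : ∀ (i : Fin 2) → opposite i ≢ i
      differs 0F ()
      differs 1F ()

    triangle-not-monochromatic : ¬ Monochromatic paint x r₁ r₂
    triangle-not-monochromatic (x≈r₁ , r₁≈r₂) =
      extend-proper (s₀∉ ∘ inj₁) (s₂∉ ∘ inj₁) (s₁∉ ∘ inj₁) s-cyclic
        (trans old₀≡old₁ old₁≡old₂ , sym old₁≡old₂)
      where
      opposite-injective : ∀ {i j : Fin 2} → opposite i ≡ opposite j → i ≡ j
      opposite-injective {i} {j} e =
        trans (sym (opposite-involutive i)) (trans (cong opposite e) (opposite-involutive j))
      old₀≡old₁ : old s₀ ≡ old s₁
      old₀≡old₁ = opposite-injective (trans (sym paint-x) (trans x≈r₁ paint-r₁))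
      old₁≡old₂ : old s₁ ≡ old s₂
      old₁≡old₂ = opposite-injective (trans (sym paint-r₁) (trans r₁≈r₂ paint-r₂))

    around : ∀ {ra rb rc sa sb} → N⁺ ra ⊆ ｛ rb ｝ ∪ ｛ sa ｝ → N⁺ rb ⊆ ｛ rc ｝ ∪ ｛ sb ｝ →
             paint ra ≢ paint sa → paint rb ≢ paint sb → ¬ Monochromatic paint ra rb rc →
             ∀ {b d} → Cyclic ra b d → ¬ Monochromatic paint ra b d
    around Na Nb a≉ b≉ ¬mono (ab , bd , _) (pab , pbd) with Na ab
    ... | inj₂ refl = a≉ pab
    ... | inj₁ refl with Nb bd
    ...   | inj₂ refl = b≉ pbd
    ...   | inj₁ refl = ¬mono (pab , pbd)

    on-triangle : ∀ {a b d} → (｛ x ｝ ∪ ｛ r₁ ｝ ∪ ｛ r₂ ｝) a → Cyclic a b d → ¬ Monochromatic paint a b d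
    on-triangle (inj₁ refl) = around Nx Nr₁ x≉s₀ r₁≉s₁ triangle-not-monochromatic
      where
      x≉s₀ = opposite-colour paint-x s₀∉
      r₁≉s₁ = opposite-colour paint-r₁ s₁∉
    on-triangle (inj₂ (inj₁ refl)) =
      around Nr₁ Nr₂ (opposite-colour paint-r₁ s₁∉) (opposite-colour paint-r₂ s₂∉)
        (triangle-not-monochromatic ∘ monochromatic-rotate {f = paint} ∘ monochromatic-rotate {f = paint})
    on-triangle (inj₂ (inj₂ refl)) =
      around Nr₂ Nx (opposite-colour paint-r₂ s₂∉) (opposite-colour paint-x s₀∉)
        (triangle-not-monochromatic ∘ monochromatic-rotate {f = paint})

-- Δ(1,2,2)-free tournaments

module Δ-free {n : ℕ} {T : Tournament n} (free : Free T Δ122) where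
  open Arcs T

  private
    containsΔ : ∀ {x y₁ y₂ z₁ z₂} → x ⟶ y₁ → x ⟶ y₂ → y₁ ⟶ y₂ → y₁ ⟶ z₁ → y₁ ⟶ z₂ → y₂ ⟶ z₁ → y₂ ⟶ z₂ →
                z₁ ⟶ z₂ → z₁ ⟶ x → z₂ ⟶ x → Contains T Δ122
    containsΔ {x} {y₁} {y₂} {z₁} {z₂} xy₁ xy₂ y₁y₂ y₁z₁ y₁z₂ y₂z₁ y₂z₂ z₁z₂ z₁x z₂x =
      embeddingFromArcs Δ122 {T = T} (x Vector.∷ y₁ Vector.∷ y₂ Vector.∷ z₁ Vector.∷ z₂ Vector.∷ λ ())
        (xy₁ All.∷ xy₂ All.∷ y₁y₂ All.∷ y₁z₁ All.∷ y₁z₂ All.∷ y₂z₁ All.∷ y₂z₂ All.∷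
         z₁x All.∷ z₁z₂ All.∷ z₂x All.∷ All.[])

  no-Δ : ∀ {x y₁ y₂ z₁ z₂} → y₁ ≢ y₂ → z₁ ≢ z₂ → x ⟶ y₁ → x ⟶ y₂ →
         y₁ ⟶ z₁ → y₁ ⟶ z₂ → y₂ ⟶ z₁ → y₂ ⟶ z₂ → z₁ ⟶ x → z₂ ⟶ x → ⊥
  no-Δ y₁≢y₂ z₁≢z₂ xy₁ xy₂ y₁z₁ y₁z₂ y₂z₁ y₂z₂ z₁x z₂x with ⟶-connex y₁≢y₂ | ⟶-connex z₁≢z₂
  ... | inj₁ y₁y₂ | inj₁ z₁z₂ = free (containsΔ xy₁ xy₂ y₁y₂ y₁z₁ y₁z₂ y₂z₁ y₂z₂ z₁z₂ z₁x z₂x)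
  ... | inj₁ y₁y₂ | inj₂ z₂z₁ = free (containsΔ xy₁ xy₂ y₁y₂ y₁z₂ y₁z₁ y₂z₂ y₂z₁ z₂z₁ z₂x z₁x)
  ... | inj₂ y₂y₁ | inj₁ z₁z₂ = free (containsΔ xy₂ xy₁ y₂y₁ y₂z₁ y₂z₂ y₁z₁ y₁z₂ z₁z₂ z₁x z₂x)
  ... | inj₂ y₂y₁ | inj₂ z₂z₁ = free (containsΔ xy₂ xy₁ y₂y₁ y₂z₂ y₂z₁ y₁z₂ y₁z₁ z₂z₁ z₂x z₁x)

  Return⁺ Return⁻ : Fin n → Fin n → Fin n → Pred (Fin n) 0ℓ
  Return⁺ y u u′ z = u′ ⟶ z × u ⟶ z × z ⟶ y
  Return⁻ y u u′ z = u′ ⟶ z × z ⟶ u × z ⟶ y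

  module Triple {y u u′ : Fin n} (yu : y ⟶ u) (yu′ : y ⟶ u′) (uu′ : u ⟶ u′) where

    return⁺-unique : AtMostOne (Return⁺ y u u′)
    return⁺-unique {z₁} {z₂} (u′z₁ , uz₁ , z₁y) (u′z₂ , uz₂ , z₂y) with z₁ ≟ z₂
    ... | yes z₁≡z₂ = z₁≡z₂
    ... | no z₁≢z₂  = ⊥-elim (no-Δ (⟶⇒≢ uu′) z₁≢z₂ yu yu′ uz₁ uz₂ u′z₁ u′z₂ z₁y z₂y)

    return⁻-unique : AtMostOne (Return⁻ y u u′)
    return⁻-unique {z₁} {z₂} (u′z₁ , z₁u , z₁y) (u′z₂ , z₂u , z₂y) with z₁ ≟ z₂
    ... | yes z₁≡z₂ = z₁≡z₂
    ... | no z₁≢z₂  = ⊥-elim (no-Δ z₁≢z₂ (⟶⇒≢ yu) u′z₁ u′z₂ z₁y z₁u z₂y z₂u yu′ uu′)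

    private
      middle≢ : ∀ {z} → u′ ⟶ z → u ≢ z
      middle≢ u′u refl = ⟶-asym uu′ u′u

      source≢ : ∀ {z} → u′ ⟶ z → y ≢ z
      source≢ u′y refl = ⟶-asym yu′ u′y

    sink-out : N⁺ u′ ⊆ N⁺ y ∪ Return⁺ y u u′ ∪ Return⁻ y u u′
    sink-out {z} u′z with y ⟶? z | ⟶-connex (middle≢ u′z)
    ... | yes yz | _       = inj₁ yz
    ... | no ¬yz | inj₁ uz = inj₂ (inj₁ (u′z , uz , ⟶-total (source≢ u′z) ¬yz))
    ... | no ¬yz | inj₂ zu = inj₂ (inj₂ (u′z , zu , ⟶-total (source≢ u′z) ¬yz))

    sink-out₂ : N⁺ y ⊆ ｛ u ｝ ∪ ｛ u′ ｝ → N⁺ u′ ⊆ Return⁺ y u u′ ∪ Return⁻ y u u′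
    sink-out₂ Ny u′z with sink-out u′z
    ... | inj₁ yz = ⊥-elim ([ middle≢ u′z , ⟶⇒≢ u′z ]′ (Ny yz))
    ... | inj₂ returns = returns

    sink-out₃ : ∀ {u″} → N⁺ y ⊆ ｛ u ｝ ∪ ｛ u′ ｝ ∪ ｛ u″ ｝ → N⁺ u′ ⊆ ｛ u″ ｝ ∪ Return⁺ y u u′ ∪ Return⁻ y u u′
    sink-out₃ Ny u′z with sink-out u′z
    ... | inj₁ yz = [ ⊥-elim ∘ middle≢ u′z , [ ⊥-elim ∘ ⟶⇒≢ u′z , inj₁ ]′ ]′ (Ny yz)
    ... | inj₂ returns = inj₂ returns

    sink-outNbhd₂ : ∀ {p q} → N⁺ y ⊆ ｛ u ｝ ∪ ｛ u′ ｝ → Return⁺ y u u′ p → Return⁻ y u u′ q →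
                    N⁺ u′ ⊆ ｛ p ｝ ∪ ｛ q ｝
    sink-outNbhd₂ Ny p⁺ q⁻ = map (return⁺-unique p⁺) (return⁻-unique q⁻) ∘ sink-out₂ Ny

    sink-outNbhd₃ : ∀ {u″ p q} → N⁺ y ⊆ ｛ u ｝ ∪ ｛ u′ ｝ ∪ ｛ u″ ｝ → Return⁺ y u u′ p → Return⁻ y u u′ q →
                    N⁺ u′ ⊆ ｛ u″ ｝ ∪ ｛ p ｝ ∪ ｛ q ｝
    sink-outNbhd₃ Ny p⁺ q⁻ = map₂ (map (return⁺-unique p⁺) (return⁻-unique q⁻)) ∘ sink-out₃ Ny

    sink-returns₂ : N⁺ y ⊆ ｛ u ｝ ∪ ｛ u′ ｝ → AtLeast₂ (N⁺ u′) → ∃ (Return⁺ y u u′) × ∃ (Return⁻ y u u′)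
    sink-returns₂ Ny two with pigeonhole₂ return⁺-unique return⁻-unique (sink-out₂ Ny) two
    ... | (p , _ , p⁺) , (q , _ , q⁻) = (p , p⁺) , (q , q⁻)

    sink-returns₃ : ∀ {u″} → N⁺ y ⊆ ｛ u ｝ ∪ ｛ u′ ｝ ∪ ｛ u″ ｝ → AtLeast₃ (N⁺ u′) →
                    u′ ⟶ u″ × ∃ (Return⁺ y u u′) × ∃ (Return⁻ y u u′)
    sink-returns₃ Ny three
      with pigeonhole₃ (λ e₁ e₂ → trans (sym e₁) e₂) return⁺-unique return⁻-unique (sink-out₃ Ny) three
    ... | (_ , u′u″ , refl) , (p , _ , p⁺) , (q , _ , q⁻) = u′u″ , (p , p⁺) , (q , q⁻)

  -- N⁺ w lies in N⁺ x ∖ {w, i, j} apart from the (at most two) returns of x → i → w.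
  outdegree-decreases : ∀ {x w i j} → x ⟶ w → x ⟶ i → x ⟶ j → i ⟶ w → j ⟶ w → i ≢ j →
                        outdegree w < outdegree x
  outdegree-decreases {x} {w} {i} {j} xw xi xj iw jw i≢j = begin-strict
    ∣ Nw ∣                             ≤⟨ p⊆q⇒∣p∣≤∣q∣ cover ⟩
    ∣ rest ∪ˢ (forward ∪ˢ backward) ∣  ≤⟨ ∣p∪q∣≤∣p∣+∣q∣ rest _ ⟩
    ∣ rest ∣ + ∣ forward ∪ˢ backward ∣ ≤⟨ +-monoʳ-≤ ∣ rest ∣ returns≤2 ⟩
    ∣ rest ∣ + 2                       <⟨ three-removed (x∈p⇒∣p-x∣<∣p∣ j∈) (x∈p⇒∣p-x∣<∣p∣ i∈)
                                                        (x∈p⇒∣p-x∣<∣p∣ w∈) ⟩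
    ∣ Nx ∣                             ∎
    where
    open ≤-Reasoning
    open Triple xi xw iw

    forward? : Decidable (Return⁺ x i w)
    forward? z = w ⟶? z ×-dec i ⟶? z ×-dec z ⟶? x
    backward? : Decidable (Return⁻ x i w)
    backward? z = w ⟶? z ×-dec z ⟶? i ×-dec z ⟶? x

    Nw Nx rest forward backward : Subset n
    Nw       = subset (w ⟶?_)
    Nx       = subset (x ⟶?_)
    rest     = Nx - w - i - j
    forward  = subset forward?
    backward = subset backward?

    w∈ : w ∈ˢ Nx
    w∈ = ∈-subset⁺ (x ⟶?_) xw
    i∈ : i ∈ˢ Nx - w
    i∈ = x∈p∧x≢y⇒x∈p-y (∈-subset⁺ (x ⟶?_) xi) (⟶⇒≢ iw)
    j∈ : j ∈ˢ Nx - w - i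
    j∈ = x∈p∧x≢y⇒x∈p-y (x∈p∧x≢y⇒x∈p-y (∈-subset⁺ (x ⟶?_) xj) (⟶⇒≢ jw)) (i≢j ∘ sym)

    ∈rest : ∀ {z} → w ⟶ z → x ⟶ z → z ∈ˢ rest
    ∈rest wz xz = x∈p∧x≢y⇒x∈p-y (x∈p∧x≢y⇒x∈p-y (x∈p∧x≢y⇒x∈p-y (∈-subset⁺ (x ⟶?_) xz)
                    (⟶⇒≢˘ wz)) (λ { refl → ⟶-asym iw wz })) (λ { refl → ⟶-asym jw wz })

    cover : Nw ⊆ˢ rest ∪ˢ (forward ∪ˢ backward)
    cover {z} z∈ with wz ← ∈-subset⁻ (w ⟶?_) z∈ | sink-out wz
    ... | inj₁ xz         = x∈p∪q⁺ (inj₁ (∈rest wz xz))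
    ... | inj₂ (inj₁ z⁺) = x∈p∪q⁺ (inj₂ (x∈p∪q⁺ (inj₁ (∈-subset⁺ forward? z⁺))))
    ... | inj₂ (inj₂ z⁻) = x∈p∪q⁺ (inj₂ (x∈p∪q⁺ (inj₂ (∈-subset⁺ backward? z⁻))))

    returns≤2 : ∣ forward ∪ˢ backward ∣ ≤ 2
    returns≤2 = ≤-trans (∣p∪q∣≤∣p∣+∣q∣ forward backward) (+-mono-≤
      (∣p∣≤1 forward λ a b → return⁺-unique (∈-subset⁻ forward? a) (∈-subset⁻ forward? b))
      (∣p∣≤1 backward λ a b → return⁻-unique (∈-subset⁻ backward? a) (∈-subset⁻ backward? b)))

    three-removed : ∀ {a b c d} → a < b → b < c → c < d → a + 2 < d
    three-removed {a} {d = d} a<b b<c c<d =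
      subst (_< d) (+-comm 2 a) (≤-trans (s≤s (s≤s a<b)) (≤-trans (s≤s b<c) c<d))

  module _ (three : ∀ v → AtLeast₃ (N⁺ v)) where

    outdegree-three : Fin n → ∃ λ x → ∃₂ λ a b → ∃ λ c →
                      a ≢ b × x ⟶ a × x ⟶ b × x ⟶ c × N⁺ x ⊆ ｛ a ｝ ∪ ｛ b ｝ ∪ ｛ c ｝
    outdegree-three v = descend v (<-wellFounded _)
      where
      descend : ∀ x → Acc _<_ (outdegree x) → ∃ λ x → ∃₂ λ a b → ∃ λ c →
                a ≢ b × x ⟶ a × x ⟶ b × x ⟶ c × N⁺ x ⊆ ｛ a ｝ ∪ ｛ b ｝ ∪ ｛ c ｝
      descend x (acc smaller)
        with a , b , c , a≢b , a≢c , b≢c , xa , xb , xc ← three x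
        with escape-or-⊆ (x ⟶?_) ((a ≟_) ∪? (b ≟_) ∪? (c ≟_))
      ... | inj₂ Nx = x , a , b , c , a≢b , xa , xb , xc , Nx
      ... | inj₁ (d , xd , d∉) with two-in-neighbours a≢b a≢c (d∉ ∘ inj₁) b≢c (d∉ ∘ inj₂ ∘ inj₁)
                                      (d∉ ∘ inj₂ ∘ inj₂) xa xb xc xd
      ... | w , i , j , xw , xi , xj , i≢j , iw , jw =
        descend w (smaller (outdegree-decreases xw xi xj iw jw i≢j))

    record Crown (x : Fin n) : Set where
      field
        a₀ a₁ a₂ p₀ p₁ p₂ : Fin n
        xa₀ : x ⟶ a₀
        xa₁ : x ⟶ a₁
        xa₂ : x ⟶ a₂
        a₀a₁ : a₀ ⟶ a₁
        a₁a₂ : a₁ ⟶ a₂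
        a₂a₀ : a₂ ⟶ a₀
        Nx : N⁺ x ⊆ ｛ a₀ ｝ ∪ ｛ a₁ ｝ ∪ ｛ a₂ ｝
        p₀⁺ : Return⁺ x a₂ a₀ p₀
        p₁⁺ : Return⁺ x a₀ a₁ p₁
        p₂⁺ : Return⁺ x a₁ a₂ p₂

      a₀p₀ : a₀ ⟶ p₀
      a₀p₀ = proj₁ p₀⁺
      a₂p₀ : a₂ ⟶ p₀
      a₂p₀ = proj₁ (proj₂ p₀⁺)
      p₀x : p₀ ⟶ x
      p₀x = proj₂ (proj₂ p₀⁺)
      a₁p₁ : a₁ ⟶ p₁
      a₁p₁ = proj₁ p₁⁺
      a₀p₁ : a₀ ⟶ p₁
      a₀p₁ = proj₁ (proj₂ p₁⁺)
      p₁x : p₁ ⟶ x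
      p₁x = proj₂ (proj₂ p₁⁺)
      a₂p₂ : a₂ ⟶ p₂
      a₂p₂ = proj₁ p₂⁺
      a₁p₂ : a₁ ⟶ p₂
      a₁p₂ = proj₁ (proj₂ p₂⁺)
      p₂x : p₂ ⟶ x
      p₂x = proj₂ (proj₂ p₂⁺)

      Nx′ : N⁺ x ⊆ ｛ a₁ ｝ ∪ ｛ a₂ ｝ ∪ ｛ a₀ ｝
      Nx′ = ⊆-∪-rotate {P = N⁺ x} Nx
      Nx″ : N⁺ x ⊆ ｛ a₂ ｝ ∪ ｛ a₀ ｝ ∪ ｛ a₁ ｝
      Nx″ = ⊆-∪-rotate {P = N⁺ x} Nx′

    crown : ∀ {x a₀ a₁ a₂} → x ⟶ a₀ → x ⟶ a₁ → x ⟶ a₂ → a₀ ⟶ a₁ → N⁺ x ⊆ ｛ a₀ ｝ ∪ ｛ a₁ ｝ ∪ ｛ a₂ ｝ →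
            Crown x
    crown {x} {a₀} {a₁} {a₂} xa₀ xa₁ xa₂ a₀a₁ Nx =
      let a₁a₂ , (p₁ , p₁⁺) , _ = Triple.sink-returns₃ xa₀ xa₁ a₀a₁ {a₂} Nx (three a₁)
          a₂a₀ , (p₂ , p₂⁺) , _ = Triple.sink-returns₃ xa₁ xa₂ a₁a₂ {a₀} (⊆-∪-rotate {P = N⁺ x} Nx) (three a₂)
          _    , (p₀ , p₀⁺) , _ =
            Triple.sink-returns₃ xa₂ xa₀ a₂a₀ {a₁} (⊆-∪-rotate {P = N⁺ x} (⊆-∪-rotate {P = N⁺ x} Nx)) (three a₀)
      in record { a₀ = a₀ ; a₁ = a₁ ; a₂ = a₂ ; p₀ = p₀ ; p₁ = p₁ ; p₂ = p₂
                ; xa₀ = xa₀ ; xa₁ = xa₁ ; xa₂ = xa₂ ; a₀a₁ = a₀a₁ ; a₁a₂ = a₁a₂ ; a₂a₀ = a₂a₀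
                ; Nx = Nx ; p₀⁺ = p₀⁺ ; p₁⁺ = p₁⁺ ; p₂⁺ = p₂⁺ }

    rotate : ∀ {x} → Crown x → Crown x
    rotate c = record { a₀ = a₁ ; a₁ = a₂ ; a₂ = a₀ ; p₀ = p₁ ; p₁ = p₂ ; p₂ = p₀
                      ; xa₀ = xa₁ ; xa₁ = xa₂ ; xa₂ = xa₀ ; a₀a₁ = a₁a₂ ; a₁a₂ = a₂a₀ ; a₂a₀ = a₀a₁
                      ; Nx = Nx′ ; p₀⁺ = p₁⁺ ; p₁⁺ = p₂⁺ ; p₂⁺ = p₀⁺ }
      where open Crown c

    -- If a₂ → p₁ then p₀ = p₁ = p₂, and the third out-neighbour q of a₂ finds no place in N⁺ p₀.
    a₂↛p₁ : ∀ {x} (c : Crown x) → ¬ Crown.a₂ c ⟶ Crown.p₁ c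
    a₂↛p₁ {x} c a₂p₁ = q-misplaced (proj₂ (proj₂ (Triple.sink-returns₃ xa₁ xa₂ a₁a₂ Nx′ (three a₂))))
      where
      open Crown c
      p₁≡p₀ : p₁ ≡ p₀
      p₁≡p₀ = Triple.return⁺-unique xa₂ xa₀ a₂a₀ (a₀p₁ , a₂p₁ , p₁x) p₀⁺
      a₁p₀ : a₁ ⟶ p₀
      a₁p₀ = subst (a₁ ⟶_) p₁≡p₀ a₁p₁
      p₀≡p₂ : p₀ ≡ p₂
      p₀≡p₂ = Triple.return⁺-unique xa₁ xa₂ a₁a₂ (a₂p₀ , a₁p₀ , p₀x) p₂⁺

      p₀⟶third : ∀ {q} → Return⁻ x a₁ a₂ q → p₀ ⟶ q
      p₀⟶third {q} q⁻ = subst (_⟶ q) (sym p₀≡p₂) (proj₁ (Triple.sink-returns₃ a₂a₀ a₂p₂ a₀p₂ Na₂ (three p₂)))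
        where
        a₀p₂ : a₀ ⟶ p₂
        a₀p₂ = subst (a₀ ⟶_) p₀≡p₂ a₀p₀
        Na₂ : N⁺ a₂ ⊆ ｛ a₀ ｝ ∪ ｛ p₂ ｝ ∪ ｛ q ｝
        Na₂ = Triple.sink-outNbhd₃ xa₁ xa₂ a₁a₂ Nx′ p₂⁺ q⁻

      q-misplaced : ¬ ∃ (Return⁻ x a₁ a₂)
      q-misplaced (q , q⁻@(a₂q , qa₁ , qx)) with Triple.sink-out a₀a₁ a₀p₀ a₁p₀ (p₀⟶third q⁻)
      ... | inj₁ a₀q with Triple.sink-out₃ xa₂ xa₀ a₂a₀ Nx″ a₀q
      ...   | inj₁ a₁≡q                = ⟶-irrefl (subst (q ⟶_) a₁≡q qa₁)
      ...   | inj₂ (inj₁ q⁺)          =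
        ⟶-irrefl (subst (_⟶ q) (Triple.return⁺-unique xa₂ xa₀ a₂a₀ p₀⁺ q⁺) (p₀⟶third q⁻))
      ...   | inj₂ (inj₂ (_ , qa₂ , _)) = ⟶-asym a₂q qa₂
      q-misplaced (q , a₂q , qa₁ , qx) | inj₂ (inj₁ (_ , a₁q , _)) = ⟶-asym a₁q qa₁
      q-misplaced (q , a₂q , qa₁ , qx) | inj₂ (inj₂ q-returns)    =
        ⟶-irrefl (subst (q ⟶_) (Triple.return⁻-unique a₀a₁ a₀p₀ a₁p₀ (p₀x , xa₁ , xa₀) q-returns) qx)

    module _ {x} (c : Crown x) (p₁a₂ : Crown.p₁ c ⟶ Crown.a₂ c) where
      open Crown c

      p₂a₀ : p₂ ⟶ a₀
      p₂a₀ with Triple.sink-out₃ xa₀ xa₁ a₀a₁ Nx a₁p₂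
      ... | inj₁ a₂≡p₂                 = ⊥-elim (⟶⇒≢ a₂p₂ a₂≡p₂)
      ... | inj₂ (inj₁ p₂-returns)     =
        ⊥-elim (⟶-asym p₁a₂ (subst (a₂ ⟶_) (sym (Triple.return⁺-unique xa₀ xa₁ a₀a₁ p₁⁺ p₂-returns)) a₂p₂))
      ... | inj₂ (inj₂ (_ , p₂a₀ , _)) = p₂a₀

      Na₀ : N⁺ a₀ ⊆ ｛ a₁ ｝ ∪ ｛ p₀ ｝ ∪ ｛ p₁ ｝
      Na₀ = Triple.sink-outNbhd₃ xa₂ xa₀ a₂a₀ Nx″ p₀⁺ (a₀p₁ , p₁a₂ , p₁x)

      p₁p₀ : p₁ ⟶ p₀
      p₁p₀ = proj₁ (Triple.sink-returns₃ a₀a₁ a₀p₁ a₁p₁ (⊆-∪-swap {P = N⁺ a₀} Na₀) (three p₁))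

      Np₁ : N⁺ p₁ ⊆ ｛ p₀ ｝ ∪ ｛ a₂ ｝ ∪ ｛ x ｝
      Np₁ = Triple.sink-outNbhd₃ a₀a₁ a₀p₁ a₁p₁ (⊆-∪-swap {P = N⁺ a₀} Na₀)
              (p₁a₂ , a₁a₂ , a₂a₀) (p₁x , xa₁ , xa₀)

    -- Otherwise p₁ → a₂, hence by rotation p₂ → a₀ and p₀ → a₁, and x, a₀, a₁, p₁, a₂, p₀, p₂ are
    -- the vertices 0, …, 6 of a copy of P7.
    Crown⇒out-closed-P7 : ∀ {x} → Crown x → OutClosedCopy T P7
    Crown⇒out-closed-P7 {x} c with Crown.a₂ c ⟶? Crown.p₁ c
    ... | yes a₂p₁ = ⊥-elim (a₂↛p₁ c a₂p₁)
    ... | no ¬a₂p₁ = P7-copy T φ out closed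
      where
      open Crown c
      c′ c″ : Crown x
      c′ = rotate c
      c″ = rotate c′
      p₁a₂ : p₁ ⟶ a₂
      p₁a₂ = ⟶-total (λ { refl → ⟶-asym xa₂ p₁x }) ¬a₂p₁
      p₀a₁ : p₀ ⟶ a₁
      p₀a₁ = p₂a₀ c′ (p₂a₀ c p₁a₂)

      φ : Fin 7 → Fin n
      φ 0F = x
      φ 1F = a₀
      φ 2F = a₁
      φ 3F = p₁
      φ 4F = a₂
      φ 5F = p₀
      φ 6F = p₂

      out : ∀ i → φ i ⟶ φ (i ⊕ 1) × φ i ⟶ φ (i ⊕ 2) × φ i ⟶ φ (i ⊕ 4)
      out 0F = xa₀ , xa₁ , xa₂
      out 1F = a₀a₁ , a₀p₁ , a₀p₀
      out 2F = a₁p₁ , a₁a₂ , a₁p₂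
      out 3F = p₁a₂ , p₁p₀ c p₁a₂ , p₁x
      out 4F = a₂p₀ , a₂p₂ , a₂a₀
      out 5F = p₁p₀ c″ p₀a₁ , p₀x , p₀a₁
      out 6F = p₂x , p₂a₀ c p₁a₂ , p₁p₀ c′ (p₂a₀ c p₁a₂)

      closed : ∀ i → N⁺ (φ i) ⊆ Image T φ
      closed 0F = ⊆-image₃ T φ 1F 2F 4F Nx
      closed 1F = ⊆-image₃ T φ 2F 5F 3F (Na₀ c p₁a₂)
      closed 2F = ⊆-image₃ T φ 4F 3F 6F (Na₀ c′ (p₂a₀ c p₁a₂))
      closed 3F = ⊆-image₃ T φ 5F 4F 0F (Np₁ c p₁a₂)
      closed 4F = ⊆-image₃ T φ 1F 6F 5F (Na₀ c″ p₀a₁)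
      closed 5F = ⊆-image₃ T φ 6F 2F 0F (Np₁ c″ p₀a₁)
      closed 6F = ⊆-image₃ T φ 3F 1F 0F (Np₁ c′ (p₂a₀ c p₁a₂))

    out-closed-P7 : Fin n → OutClosedCopy T P7
    out-closed-P7 v with x , a , b , c , a≢b , xa , xb , xc , Nx ← outdegree-three v with ⟶-connex a≢b
    ... | inj₁ ab = Crown⇒out-closed-P7 (crown xa xb xc ab Nx)
    ... | inj₂ ba = Crown⇒out-closed-P7 (crown xb xa xc ba (⊆-∪-swap {P = N⁺ x} (⊆-∪-rotate {P = N⁺ x} Nx)))

  out-closed-C5 : ∀ {x p q c d} → x ⟶ p → x ⟶ q → p ⟶ q → N⁺ x ⊆ ｛ p ｝ ∪ ｛ q ｝ →
              Return⁺ x p q c → Return⁻ x p q d → c ⟶ d → OutClosedCopy T C5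
  out-closed-C5 {x} {p} {q} {c} {d} xp xq pq Nx c⁺@(qc , pc , cx) d⁻@(qd , dp , dx) cd =
    C5-copy T φ out closed
    where
    Nq : N⁺ q ⊆ ｛ c ｝ ∪ ｛ d ｝
    Nq = Triple.sink-outNbhd₂ xp xq pq Nx c⁺ d⁻
    Nd : N⁺ d ⊆ ｛ x ｝ ∪ ｛ p ｝
    Nd = Triple.sink-outNbhd₂ qc qd cd Nq (dx , cx , xq) (dp , pc , pq)
    Np : N⁺ p ⊆ ｛ q ｝ ∪ ｛ c ｝
    Np = Triple.sink-outNbhd₂ dx dp xp Nd (pq , xq , qd) (pc , cx , cd)
    Nc : N⁺ c ⊆ ｛ d ｝ ∪ ｛ x ｝
    Nc = Triple.sink-outNbhd₂ pq pc qc Np (cd , qd , dp) (cx , xq , xp)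

    φ : Fin 5 → Fin n
    φ 0F = x
    φ 1F = p
    φ 2F = q
    φ 3F = c
    φ 4F = d

    out : ∀ i → φ i ⟶ φ (i ⊕ 1) × φ i ⟶ φ (i ⊕ 2)
    out 0F = xp , xq
    out 1F = pq , pc
    out 2F = qc , qd
    out 3F = cd , cx
    out 4F = dx , dp

    closed : ∀ i → N⁺ (φ i) ⊆ Image T φ
    closed 0F = ⊆-image₂ T φ 1F 2F Nx
    closed 1F = ⊆-image₂ T φ 2F 3F Np
    closed 2F = ⊆-image₂ T φ 3F 4F Nq
    closed 3F = ⊆-image₂ T φ 4F 0F Nc
    closed 4F = ⊆-image₂ T φ 0F 1F Nd

module Step {n : ℕ} {T : Tournament (suc n)} (free : Free T Δ122) where
  open Arcs T
  open Δ-free {T = T} free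

  3-colourable : (∀ v → Colourable (T ∖ v) 3) → Colourable T 3
  3-colourable ih with any? (λ x → any? λ w₁ → any? λ w₂ → ⊆-dec (x ⟶?_) ((w₁ ≟_) ∪? (w₂ ≟_)))
  ... | yes (x , w₁ , w₂ , Nx) = colour-x (missing-colour₃ (extend 0F w₁) (extend 0F w₂))
    where
    open Recolouring {T = T} x (proj₂ (ih x))
    colour-x : (∃ λ i → extend 0F w₁ ≢ i × extend 0F w₂ ≢ i) → Colourable T 3
    colour-x (i , w₁≉i , w₂≉i) =
      extend-missing {i} {0F} λ xw → [ (λ { refl → w₁≉i }) , (λ { refl → w₂≉i }) ]′ (Nx xw)
  ... | no ¬low = Recolouring.recolour-copy {T = T} x (proj₂ (ih x)) copy (0F , refl) P7-3-colourable
    where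
    copy : OutClosedCopy T P7
    copy = out-closed-P7 (outdegree≥3 λ x w₁ w₂ Nx → ¬low (x , w₁ , w₂ , Nx)) zero
    x : Fin (suc n)
    x = OutClosedCopy.φ copy 0F

  2-colourable-at-outdegree-2 : (∀ v → AtLeast₂ (N⁺ v)) → (∀ v → Colourable (T ∖ v) 2) →
                                ∀ {x p q} → x ⟶ p → x ⟶ q → p ⟶ q → N⁺ x ⊆ ｛ p ｝ ∪ ｛ q ｝ → Colourable T 2
  2-colourable-at-outdegree-2 two ih {x} {p} {q} xp xq pq Nx with Triple.sink-returns₂ xp xq pq Nx (two q)
  ... | (c , c⁺@(qc , pc , cx)) , (d , d⁻@(qd , dp , dx)) with c ⟶? d
  ... | yes cd =
    Recolouring.recolour-copy {T = T} x (proj₂ (ih x)) (out-closed-C5 xp xq pq Nx c⁺ d⁻ cd) (0F , refl)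
      C5-2-colourable
  ... | no ¬cd = via-triangle (proj₂ (Triple.sink-returns₂ qd qc dc (swap ∘ Nq) (two c)))
    where
    dc : d ⟶ c
    dc = ⟶-total (λ { refl → ⟶-asym pc dp }) ¬cd
    Nq : N⁺ q ⊆ ｛ c ｝ ∪ ｛ d ｝
    Nq = Triple.sink-outNbhd₂ xp xq pq Nx c⁺ d⁻

    via-triangle : ∃ (Return⁻ q d c) → Colourable T 2
    via-triangle (y , y⁻@(cy , yd , yq)) =
      TriangleRecolouring.recolour-triangle {T = T} x (proj₂ (ih x)) xq qc cx (swap ∘ Nx) Nq Nc (py , yd , dp)
        (∉-three (⟶⇒≢ xp) (⟶⇒≢˘ pq) (⟶⇒≢˘ pc))
        (∉-three (⟶⇒≢˘ dx) (⟶⇒≢ qd) (⟶⇒≢˘ dc))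
        (∉-three (⟶⇒≢˘ yx) (⟶⇒≢˘ yq) (⟶⇒≢ cy))
      where
      Nc : N⁺ c ⊆ ｛ x ｝ ∪ ｛ y ｝
      Nc = Triple.sink-outNbhd₂ qd qc dc (swap ∘ Nq) (cx , dx , xq) y⁻
      yx : y ⟶ x
      yx = ⟶-total (λ { refl → ⟶-asym yd dx })
             λ xy → [ (λ { refl → ⟶-asym yd dp }) , (λ { refl → ⟶-irrefl yq }) ]′ (Nx xy)
      py : p ⟶ y
      py with Triple.sink-out₂ cy cx yx (swap ∘ Nc) xp
      ... | inj₁ p⁺           = ⊥-elim (⟶⇒≢ pq (Triple.return⁺-unique cy cx yx p⁺ (xq , yq , qc)))
      ... | inj₂ (_ , py , _) = py

  2-colourable : Free T P7 → (∀ v → Colourable (T ∖ v) 2) → Colourable T 2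
  2-colourable P7-free ih with any? (λ x → any? λ w → ⊆-dec (x ⟶?_) (w ≟_))
  ... | yes (x , w , Nx) = colour-x (missing-colour₂ (extend 0F w))
    where
    open Recolouring {T = T} x (proj₂ (ih x))
    colour-x : (∃ λ i → extend 0F w ≢ i) → Colourable T 2
    colour-x (i , w≉i) = extend-missing {i} {0F} λ xw → subst (λ v → extend 0F v ≢ i) (Nx xw) w≉i
  ... | no ¬low = split-on-outdegree-3 (all? (λ v → atLeast₃? (v ⟶?_)))
    where
    two : ∀ v → AtLeast₂ (N⁺ v)
    two = outdegree≥2 λ x w Nx → ¬low (x , w , Nx)

    split-on-outdegree-3 : Dec (∀ v → AtLeast₃ (N⁺ v)) → Colourable T 2
    split-on-outdegree-3 (yes three) = ⊥-elim (P7-free (OutClosedCopy.contains (out-closed-P7 three zero)))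
    split-on-outdegree-3 (no ¬three) with ¬∀⟶∃¬ (suc n) _ (λ v → atLeast₃? (v ⟶?_)) ¬three
    ... | v , ¬three-v with outdegree-exactly-2 (two v) ¬three-v
    ... | _ , _ , vp , vq , pq , Nv = 2-colourable-at-outdegree-2 two ih vp vq pq Nv

Δ-free⇒3-colourable : ∀ {n} (T : Tournament n) → Free T Δ122 → Colourable T 3
Δ-free⇒3-colourable {zero}  T free = (λ ()) , λ _ ()
Δ-free⇒3-colourable {suc n} T free =
  Step.3-colourable {T = T} free λ v → Δ-free⇒3-colourable (T ∖ v) (Free-∖ {T = T} {Δ122} {v} free)

Δ-free⇒P7-free⇒2-colourable : ∀ {n} (T : Tournament n) → Free T Δ122 → Free T P7 → Colourable T 2
Δ-free⇒P7-free⇒2-colourable {zero}  T free P7-free = (λ ()) , λ _ ()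
Δ-free⇒P7-free⇒2-colourable {suc n} T free P7-free = Step.2-colourable {T = T} free P7-free λ v →
  Δ-free⇒P7-free⇒2-colourable (T ∖ v) (Free-∖ {T = T} {Δ122} {v} free) (Free-∖ {T = T} {P7} {v} P7-free)

2-colourable⇒P7-free : ∀ {n} (T : Tournament n) → Colourable T 2 → Free T P7
2-colourable⇒P7-free T colourable copy = P7-not-2-colourable (Colourable-⊇ {T = T} {P7} copy colourable)

theorem1p3 : ∀ {n : ℕ} (T : Tournament n) → Free T Δ122 →
    Colourable T 3 × (Colourable T 2 ⇔ Free T P7)
theorem1p3 T free =
  Δ-free⇒3-colourable T free , mk⇔ (2-colourable⇒P7-free T) (Δ-free⇒P7-free⇒2-colourable T free)
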